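{- Let $p$ be a prime with $p\equiv1\pmod4$, let $u_p=(t+b\sqrt p)/2>1$ ($t,b$ positive integers) be the fundamental unit of $\mathbb Q(\sqrt p)$, and let $A,B$ be integers with $p=A^2+B^2$, $A\equiv-1\pmod4$ and $p\mid At+2B$. Let $x_0:=\sqrt{\frac{bp+(At+2B)}{2p}}$ and $y_0:=\kappa\sqrt{\frac{bp-(At+2B)}{2p}}$, where $\kappa\in\{1,-1\}$ is chosen so that $x_0y_0=\frac{Bt-2A}{2p}$. Then $x_0,y_0\in\mathbb Z$.
   Context: One has $bp\ge|At+2B|$, so the square roots are real, and $\sqrt{\frac{bp-(At+2B)}{2p}}\sqrt{\frac{bp+(At+2B)}{2p}}=\frac{|Bt-2A|}{2p}$, so such $\kappa$ exists. -}

module Defs where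

open import Data.Nat using (ℕ)
open import Data.Integer using (ℤ; +_; _+_; _-_; _*_; -_; _≤_; _<_; _>_; 0ℤ)
open import Data.Product using (_×_)
open import Data.Sum using (_⊎_)
open import Relation.Binary.PropositionalEquality using (_≡_)

-- Elements of ℚ(√p) of the shape a + c·√p with a c : ℤ.
-- NonNeg p a c  :⇔  a + c·√p ≥ 0   (as a real number), decided without reals.
NonNeg : ℕ → ℤ → ℤ → Set
NonNeg p a c =
    (0ℤ ≤ a × 0ℤ ≤ c)
  ⊎ (0ℤ ≤ a × c < 0ℤ × (+ p) * (c * c) ≤ a * a)
  ⊎ (a < 0ℤ × 0ℤ < c × a * a ≤ (+ p) * (c * c))

-- Pos p a c  :⇔  a + c·√p > 0.
Pos : ℕ → ℤ → ℤ → Set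
Pos p a c =
    (0ℤ ≤ a × 0ℤ ≤ c × (0ℤ < a ⊎ 0ℤ < c))
  ⊎ (0ℤ ≤ a × c < 0ℤ × (+ p) * (c * c) < a * a)
  ⊎ (a < 0ℤ × 0ℤ < c × a * a < (+ p) * (c * c))

-- (t + b√p)/2 is a unit of the ring of integers of ℚ(√p) (p ≡ 1 mod 4):
-- it lies in ℤ[(1+√p)/2] and has norm ±1, i.e. t² - p b² = ±4
-- (this norm equation already forces t ≡ b mod 2, i.e. integrality).
IsUnit : ℕ → ℤ → ℤ → Set
IsUnit p t b = (t * t - (+ p) * (b * b) ≡ + 4) ⊎ (t * t - (+ p) * (b * b) ≡ - (+ 4))

-- u = (t + b√p)/2 is the fundamental unit of ℚ(√p): the smallest unit > 1.
-- (t + b√p)/2 > 1  ⇔  (t - 2) + b√p > 0;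
-- (t' + b'√p)/2 ≥ (t + b√p)/2  ⇔  (t' - t) + (b' - b)√p ≥ 0.
IsFundamentalUnit : ℕ → ℤ → ℤ → Set
IsFundamentalUnit p t b =
  IsUnit p t b × Pos p (t - + 2) b ×
  ((t' b' : ℤ) → IsUnit p t' b' → Pos p (t' - + 2) b' → NonNeg p (t' - t) (b' - b))

{-# OPTIONS --safe #-}
-- Write S = At + 2B and D = Bt − 2A. Since S² + D² = (A² + B²)(t² + 4) = p(t² + 4), the
-- prime p divides D as well as S; with S = sp, D = dp this gives p(s² + d²) = t² + 4 and
-- Bs − Ad = 2. A unit of norm +1 would make p divide 8, so t² + 4 = pb² and s² + d² = b².
-- As A is odd and B even, Bs − Ad = 2 forces d = 2e, and then b ≡ s (mod 2), so
-- b = X + Y, s = X − Y with XY = e². Halving gives β(X − Y) − Ae = 1 (B = 2β), so X and Y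
-- are coprime and nonnegative, hence squares x², y² with xy = e; these x, y are x₀, y₀.
module Submission where

module ℕ-Lemmas where
  open import Data.Nat.Base
  open import Data.Nat.Properties
  open import Data.Nat.Divisibility
  open import Data.Nat.GCD
  open import Data.Nat.Coprimality using (Coprime; coprime-factors)
  import Data.Nat.Coprimality as Coprimality
  open import Algebra.Properties.CommutativeSemigroup *-commutativeSemigroup
    using () renaming (interchange to *-interchange)
  open import Relation.Binary.Definitions using (tri<; tri≈; tri>)
  open import Relation.Binary.PropositionalEquality
  open import Data.Product using (_×_; _,_; ∃₂)
  open import Data.Empty using (⊥-elim)
  open import Data.Nat.Primality using (Prime; euclidsLemma; prime⇒nonTrivial)
  open import Data.Sum using (reduce; [_,_]′)
  open import Function using (id)

  square-injective : ∀ {m n} → m * m ≡ n * n → m ≡ n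
  square-injective {m} {n} eq with <-cmp m n
  ... | tri< m<n _ _ = ⊥-elim (<-irrefl eq (*-mono-< m<n m<n))
  ... | tri≈ _ m≡n _ = m≡n
  ... | tri> _ _ n<m = ⊥-elim (<-irrefl (sym eq) (*-mono-< n<m n<m))

  coprime-factor-of-square : ∀ {m n k} → Coprime m n → m * n ≡ k * k →
                             m ≡ gcd m k * gcd m k
  coprime-factor-of-square {m} {n} {k} coprime mn≡kk = ∣-antisym m∣g*g g*g∣m
    where
    g = gcd m k
    m∣k*g : m ∣ k * g
    m∣k*g = subst (m ∣_) (sym (c*gcd[m,n]≡gcd[cm,cn] k m k))
              (gcd-greatest (n∣m*n k) (subst (m ∣_) mn≡kk (m∣m*n n)))
    m∣g*g : m ∣ g * g
    m∣g*g = subst (m ∣_) (sym (c*gcd[m,n]≡gcd[cm,cn] g m k))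
              (gcd-greatest (n∣m*n g) (subst (m ∣_) (*-comm k g) m∣k*g))
    g*g∣m : g * g ∣ m
    g*g∣m = coprime-factors coprime
      ( *-pres-∣ (gcd[m,n]∣m m k) (gcd[m,n]∣m m k)
      , subst (g * g ∣_) (sym (trans (*-comm n m) mn≡kk))
          (*-pres-∣ (gcd[m,n]∣n m k) (gcd[m,n]∣n m k)))

  coprime-factors-of-square : ∀ {m n k} → Coprime m n → m * n ≡ k * k →
                              ∃₂ λ x y → m ≡ x * x × n ≡ y * y × x * y ≡ k
  coprime-factors-of-square {m} {n} {k} coprime mn≡kk =
    x , y , m≡x*x , n≡y*y , square-injective (begin
      x * y * (x * y) ≡⟨ *-interchange x y x y ⟩
      x * x * (y * y) ≡⟨ cong₂ _*_ m≡x*x n≡y*y ⟨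
      m * n           ≡⟨ mn≡kk ⟩
      k * k           ∎)
    where
    open ≡-Reasoning
    x = gcd m k
    y = gcd n k
    m≡x*x = coprime-factor-of-square coprime mn≡kk
    n≡y*y = coprime-factor-of-square (Coprimality.sym coprime) (trans (*-comm n m) mn≡kk)

  prime∣8⇒≡2 : ∀ {p} → Prime p → p ∣ 8 → p ≡ 2
  prime∣8⇒≡2 {p} p-prime p∣8 = ≤-antisym (∣⇒≤ p∣2) (nonTrivial⇒n>1 p {{prime⇒nonTrivial p-prime}})
    where
    p∣2 : p ∣ 2
    p∣2 = [ id , (λ p∣4 → reduce (euclidsLemma 2 2 p-prime p∣4)) ]′ (euclidsLemma 2 4 p-prime p∣8)


open import Defs
open import Data.Nat using (ℕ)
open import Data.Nat.Primality using (Prime)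
open import Data.Integer using (ℤ; +_; _+_; _-_; _*_; -_; _≤_; _<_; 0ℤ)
open import Data.Integer.Divisibility using (_∣_)
open import Data.Product using (_×_; ∃₂)
open import Relation.Binary.PropositionalEquality using (_≡_)

import Data.Nat as ℕ
open import Data.Nat.Properties using (1+n≢n)
open import Data.Nat.Divisibility using (∣1⇒≡1) renaming (_∣_ to _∣ℕ_)
open import Data.Nat.Primality using (euclidsLemma; prime[2]; prime⇒nonZero)
open import Data.Integer using (-[1+_]; +[1+_]; 1ℤ; NonZero; ∣_∣; sign; _◃_; +≤+)
open import Data.Integer.Coprimality using (Coprime)
open import Data.Integer.Divisibility.Signed
  using (divides; ∣ᵤ⇒∣; ∣⇒∣ᵤ; ∣-refl; ∣-reflexive; ∣-trans; ∣m∣n⇒∣m+n; ∣m∣n⇒∣m-n; ∣n⇒∣m*n; ∣m⇒∣m*n)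
  renaming (_∣_ to _∣ₛ_)
open import Data.Integer.Properties
  using (+-comm; +-identityˡ; *-comm; abs-*; pos-*; ◃-distrib-*; ◃-inverse; +◃n≡+n; 0≤i⇒+∣i∣≡i;
         *-cancelˡ-≡; *-cancelʳ-≡)
open import Data.Integer.Tactic.RingSolver using (solve-∀)
open import Data.Product using (_,_)
import Data.Sign as Sign
open import Data.Sign.Properties using (s*s≡+)
open import Data.Sum using (_⊎_; inj₁; inj₂; reduce; [_,_]′)
import Data.Sum as Sum
open import Function using (id)
open import Relation.Binary.PropositionalEquality
  using (_≢_; refl; sym; trans; cong; cong₂; subst; module ≡-Reasoning)
open import Relation.Nullary using (¬_; contradiction)

open ℕ-Lemmas using (coprime-factors-of-square; prime∣8⇒≡2)

prime-∣-* : ∀ {p} m n → Prime p → + p ∣ₛ m * n → + p ∣ₛ m ⊎ + p ∣ₛ n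
prime-∣-* {p} m n p-prime p∣mn = Sum.map ∣ᵤ⇒∣ ∣ᵤ⇒∣
  (euclidsLemma ∣ m ∣ ∣ n ∣ p-prime (subst (p ∣ℕ_) (abs-* m n) (∣⇒∣ᵤ p∣mn)))

prime-∣-square : ∀ {p} n → Prime p → + p ∣ₛ n * n → + p ∣ₛ n
prime-∣-square n p-prime p∣n*n = reduce (prime-∣-* n n p-prime p∣n*n)

bézout⇒coprime : ∀ u m v n → u * m + v * n ≡ 1ℤ → Coprime m n
bézout⇒coprime u m v n bézout {i} (i∣m , i∣n) = ∣1⇒≡1 (∣⇒∣ᵤ (subst (+ i ∣ₛ_) bézout
  (∣m∣n⇒∣m+n (∣n⇒∣m*n u (∣ᵤ⇒∣ {+ i} {m} i∣m)) (∣n⇒∣m*n v (∣ᵤ⇒∣ {+ i} {n} i∣n)))))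

square-nonneg : ∀ k → 0ℤ ≤ k * k
square-nonneg (+ n)    = subst (0ℤ ≤_) (pos-* n n) (+≤+ ℕ.z≤n)
square-nonneg -[1+ n ] = +≤+ ℕ.z≤n

factor-of-square-nonneg : ∀ m n k → 0ℤ < m + n → m * n ≡ k * k → 0ℤ ≤ m
factor-of-square-nonneg (+ _)      _         _ _ _ = +≤+ ℕ.z≤n
factor-of-square-nonneg -[1+ _ ] -[1+ _ ]    _ () _
factor-of-square-nonneg -[1+ _ ] (+ 0)       _ () _
factor-of-square-nonneg -[1+ _ ] +[1+ _ ]    k _ mn≡kk
  with () ← subst (0ℤ ≤_) (sym mn≡kk) (square-nonneg k)

square-roots-of-coprime-factors : ∀ {m n k} → 0ℤ ≤ m → 0ℤ ≤ n → Coprime m n → m * n ≡ k * k →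
                                  ∃₂ λ x y → 0ℤ ≤ x × m ≡ x * x × n ≡ y * y × x * y ≡ k
square-roots-of-coprime-factors {m} {n} {k} 0≤m 0≤n coprime mn≡kk
  with x , y , ∣m∣≡x*x , ∣n∣≡y*y , x*y≡∣k∣ ← coprime-factors-of-square coprime
         (trans (sym (abs-* m n)) (trans (cong ∣_∣ mn≡kk) (abs-* k k)))
  = + x , s ◃ y , +≤+ ℕ.z≤n , m≡x*x , n≡y*y , x*y≡k
  where
  open ≡-Reasoning
  s = sign k
  m≡x*x : m ≡ + x * + x
  m≡x*x = begin
    m           ≡⟨ 0≤i⇒+∣i∣≡i 0≤m ⟨
    + ∣ m ∣     ≡⟨ cong +_ ∣m∣≡x*x ⟩
    + (x ℕ.* x) ≡⟨ pos-* x x ⟩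
    + x * + x   ∎
  n≡y*y : n ≡ (s ◃ y) * (s ◃ y)
  n≡y*y = begin
    n                        ≡⟨ 0≤i⇒+∣i∣≡i 0≤n ⟨
    + ∣ n ∣                  ≡⟨ cong +_ ∣n∣≡y*y ⟩
    + (y ℕ.* y)              ≡⟨ +◃n≡+n (y ℕ.* y) ⟨
    Sign.+ ◃ (y ℕ.* y)       ≡⟨ cong (_◃ (y ℕ.* y)) (s*s≡+ s) ⟨
    (s Sign.* s) ◃ (y ℕ.* y) ≡⟨ ◃-distrib-* s s y y ⟩
    (s ◃ y) * (s ◃ y)        ∎
  x*y≡k : + x * (s ◃ y) ≡ k
  x*y≡k = begin
    + x * (s ◃ y)          ≡⟨ cong (_* (s ◃ y)) (+◃n≡+n x) ⟨
    (Sign.+ ◃ x) * (s ◃ y) ≡⟨ ◃-distrib-* Sign.+ s x y ⟨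
    s ◃ (x ℕ.* y)          ≡⟨ cong (s ◃_) x*y≡∣k∣ ⟩
    s ◃ ∣ k ∣              ≡⟨ ◃-inverse k ⟩
    k                      ∎

square-roots-of-factors : ∀ {X Y e} β A → 0ℤ < X + Y → X * Y ≡ e * e → β * (X - Y) ≡ 1ℤ + A * e →
                          ∃₂ λ x y → 0ℤ ≤ x × X ≡ x * x × Y ≡ y * y × x * y ≡ e
square-roots-of-factors {X} {Y} {e} β A 0<X+Y XY≡ee β[X-Y]≡1+Ae =
  square-roots-of-coprime-factors
    (factor-of-square-nonneg X Y e 0<X+Y XY≡ee)
    (factor-of-square-nonneg Y X e (subst (0ℤ <_) (+-comm X Y) 0<X+Y) (trans (*-comm Y X) XY≡ee))
    (bézout⇒coprime u X v Y bézout)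
    XY≡ee
  where
  open ≡-Reasoning
  -- Squaring β(X − Y) − 1 = Ae and substituting e² = XY gives the Bézout relation.
  w = + 2 - β * (X - Y)
  u = A * A * Y + β * w
  v = - (β * w)
  expand : ∀ A β X Y → (A * A * Y + β * (+ 2 - β * (X - Y))) * X + - (β * (+ 2 - β * (X - Y))) * Y
                       ≡ A * A * (X * Y) + β * (X - Y) * (+ 2 - β * (X - Y))
  expand = solve-∀
  collapse : ∀ A e → A * A * (e * e) + (1ℤ + A * e) * (+ 2 - (1ℤ + A * e)) ≡ 1ℤ
  collapse = solve-∀
  bézout : u * X + v * Y ≡ 1ℤ
  bézout = begin
    u * X + v * Y
      ≡⟨ expand A β X Y ⟩
    A * A * (X * Y) + β * (X - Y) * (+ 2 - β * (X - Y))
      ≡⟨ cong₂ (λ z k → A * A * z + k * (+ 2 - k)) XY≡ee β[X-Y]≡1+Ae ⟩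
    A * A * (e * e) + (1ℤ + A * e) * (+ 2 - (1ℤ + A * e))
      ≡⟨ collapse A e ⟩
    1ℤ ∎

Even : ℤ → Set
Even n = + 2 ∣ₛ n

4∣⇒even : ∀ {n} → + 4 ∣ n → Even n
4∣⇒even {n} 4∣n = ∣-trans (divides (+ 2) refl) (∣ᵤ⇒∣ {+ 4} {n} 4∣n)

odd⇒¬even : ∀ A → Even (A + 1ℤ) → ¬ Even A
odd⇒¬even A 2∣A+1 2∣A = 1+n≢n (∣1⇒≡1 (∣⇒∣ᵤ (subst Even (difference A) (∣m∣n⇒∣m-n 2∣A+1 2∣A))))
  where
  difference : ∀ A → (A + 1ℤ) - A ≡ 1ℤ
  difference = solve-∀

even-square-summand : ∀ A B → Even (A + 1ℤ) → Even (A * A + B * B - 1ℤ) → Even B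
even-square-summand A B 2∣A+1 2∣A²+B²-1 =
  prime-∣-square B prime[2] (subst Even (sym (B² A B)) (∣m∣n⇒∣m-n 2∣A²+B²-1 (∣m⇒∣m*n (A - 1ℤ) 2∣A+1)))
  where
  B² : ∀ A B → B * B ≡ (A * A + B * B - 1ℤ) - (A + 1ℤ) * (A - 1ℤ)
  B² = solve-∀

even-of-cross : ∀ A B s d → Even B → ¬ Even A → B * s - A * d ≡ + 2 → Even d
even-of-cross A B s d 2∣B 2∤A Bs-Ad≡2 =
  [ (λ 2∣A → contradiction 2∣A 2∤A) , id ]′ (prime-∣-* A d prime[2] (subst Even (sym Ad≡) 2∣Bs-2))
  where
  rearrange : ∀ A B s d → A * d ≡ B * s - (B * s - A * d)
  rearrange = solve-∀
  Ad≡ : A * d ≡ B * s - + 2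
  Ad≡ = trans (rearrange A B s d) (cong (λ k → B * s - k) Bs-Ad≡2)
  2∣Bs-2 : Even (B * s - + 2)
  2∣Bs-2 = ∣m∣n⇒∣m-n (∣m⇒∣m*n s 2∣B) (divides 1ℤ refl)

even-leg-difference : ∀ s d b → Even d → s * s + d * d ≡ b * b → Even (b - s)
even-leg-difference s d b 2∣d s²+d²≡b² =
  [ id , (λ 2∣b+s → subst Even (sym (b-s≡ b s)) (∣m∣n⇒∣m-n 2∣b+s (divides s refl))) ]′
    (prime-∣-* (b - s) (b + s) prime[2] (subst Even (sym [b-s][b+s]≡dd) (∣m⇒∣m*n d 2∣d)))
  where
  open ≡-Reasoning
  b-s≡ : ∀ b s → b - s ≡ (b + s) - s * + 2
  b-s≡ = solve-∀
  factor : ∀ b s → (b - s) * (b + s) ≡ b * b - s * s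
  factor = solve-∀
  cancel : ∀ s d → (s * s + d * d) - s * s ≡ d * d
  cancel = solve-∀
  [b-s][b+s]≡dd : (b - s) * (b + s) ≡ d * d
  [b-s][b+s]≡dd = begin
    (b - s) * (b + s)         ≡⟨ factor b s ⟩
    b * b - s * s             ≡⟨ cong (_- s * s) s²+d²≡b² ⟨
    (s * s + d * d) - s * s   ≡⟨ cancel s d ⟩
    d * d                     ∎

split-even-difference : ∀ b s → Even (b - s) → ∃₂ λ X Y → b ≡ X + Y × s ≡ X - Y
split-even-difference b s (divides Y b-s≡Y*2) = Y + s , Y , b≡X+Y , s≡X-Y s Y
  where
  open ≡-Reasoning
  s≡X-Y : ∀ s Y → s ≡ (Y + s) - Y
  s≡X-Y = solve-∀
  restore : ∀ b s → b ≡ (b - s) + s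
  restore = solve-∀
  regroup : ∀ Y s → Y * + 2 + s ≡ (Y + s) + Y
  regroup = solve-∀
  b≡X+Y : b ≡ (Y + s) + Y
  b≡X+Y = begin
    b           ≡⟨ restore b s ⟩
    (b - s) + s ≡⟨ cong (_+ s) b-s≡Y*2 ⟩
    Y * + 2 + s ≡⟨ regroup Y s ⟩
    (Y + s) + Y ∎

pythagorean-halves : ∀ X Y e → (X - Y) * (X - Y) + (e * + 2) * (e * + 2) ≡ (X + Y) * (X + Y) →
                     X * Y ≡ e * e
pythagorean-halves X Y e pythagoras = *-cancelˡ-≡ (+ 4) (X * Y) (e * e) (begin
  + 4 * (X * Y)                                                   ≡⟨ difference-of-squares X Y ⟩
  (X + Y) * (X + Y) - (X - Y) * (X - Y)                           ≡⟨ cong (_- (X - Y) * (X - Y)) pythagoras ⟨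
  ((X - Y) * (X - Y) + (e * + 2) * (e * + 2)) - (X - Y) * (X - Y) ≡⟨ cancel X Y e ⟩
  + 4 * (e * e)                                                   ∎)
  where
  open ≡-Reasoning
  difference-of-squares : ∀ X Y → + 4 * (X * Y) ≡ (X + Y) * (X + Y) - (X - Y) * (X - Y)
  difference-of-squares = solve-∀
  cancel : ∀ X Y e → ((X - Y) * (X - Y) + (e * + 2) * (e * + 2)) - (X - Y) * (X - Y) ≡ + 4 * (e * e)
  cancel = solve-∀

halve-cross : ∀ A β s e → (β * + 2) * s - A * (e * + 2) ≡ + 2 → β * s ≡ 1ℤ + A * e
halve-cross A β s e cross≡2 = *-cancelˡ-≡ (+ 2) (β * s) (1ℤ + A * e) (begin
  + 2 * (β * s)                                   ≡⟨ split A β s e ⟩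
  ((β * + 2) * s - A * (e * + 2)) + + 2 * (A * e) ≡⟨ cong (_+ + 2 * (A * e)) cross≡2 ⟩
  + 2 + + 2 * (A * e)                             ≡⟨ factor A e ⟩
  + 2 * (1ℤ + A * e)                              ∎)
  where
  open ≡-Reasoning
  split : ∀ A β s e → + 2 * (β * s) ≡ ((β * + 2) * s - A * (e * + 2)) + + 2 * (A * e)
  split = solve-∀
  factor : ∀ A e → + 2 + + 2 * (A * e) ≡ + 2 * (1ℤ + A * e)
  factor = solve-∀

complement-divisible : ∀ {p} A B t → Prime p → + p ≡ A * A + B * B →
                       + p ∣ₛ A * t + + 2 * B → + p ∣ₛ B * t - + 2 * A
complement-divisible {p} A B t p-prime p≡A²+B² p∣S =
  prime-∣-square (B * t - + 2 * A) p-prime (subst (+ p ∣ₛ_) (lagrange A B t)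
    (∣m∣n⇒∣m-n (∣m⇒∣m*n (t * t + + 4) (∣-reflexive p≡A²+B²)) (∣m⇒∣m*n (A * t + + 2 * B) p∣S)))
  where
  lagrange : ∀ A B t → (A * A + B * B) * (t * t + + 4) - (A * t + + 2 * B) * (A * t + + 2 * B)
                       ≡ (B * t - + 2 * A) * (B * t - + 2 * A)
  lagrange = solve-∀

quotient-identities : ∀ {P} A B t s d .{{_ : NonZero P}} → P ≡ A * A + B * B →
                      A * t + + 2 * B ≡ s * P → B * t - + 2 * A ≡ d * P →
                      t * t + + 4 ≡ (s * s + d * d) * P × B * s - A * d ≡ + 2
quotient-identities {P} A B t s d P≡A²+B² S≡sP D≡dP =
  *-cancelʳ-≡ (t * t + + 4) ((s * s + d * d) * P) P (begin
    (t * t + + 4) * P                             ≡⟨ cong ((t * t + + 4) *_) P≡A²+B² ⟩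
    (t * t + + 4) * (A * A + B * B)               ≡⟨ lagrange A B t ⟩
    (A * t + + 2 * B) * (A * t + + 2 * B) + (B * t - + 2 * A) * (B * t - + 2 * A)
                                                  ≡⟨ cong₂ (λ u v → u * u + v * v) S≡sP D≡dP ⟩
    (s * P) * (s * P) + (d * P) * (d * P)         ≡⟨ regroup s d P ⟩
    (s * s + d * d) * P * P                       ∎)
  , *-cancelʳ-≡ (B * s - A * d) (+ 2) P (begin
    (B * s - A * d) * P                           ≡⟨ distribute B s A d P ⟩
    B * (s * P) - A * (d * P)                     ≡⟨ cong₂ (λ u v → B * u - A * v) S≡sP D≡dP ⟨
    B * (A * t + + 2 * B) - A * (B * t - + 2 * A) ≡⟨ cross A B t ⟩
    + 2 * (A * A + B * B)                         ≡⟨ cong (+ 2 *_) P≡A²+B² ⟨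
    + 2 * P                                       ∎)
  where
  open ≡-Reasoning
  lagrange : ∀ A B t → (t * t + + 4) * (A * A + B * B)
             ≡ (A * t + + 2 * B) * (A * t + + 2 * B) + (B * t - + 2 * A) * (B * t - + 2 * A)
  lagrange = solve-∀
  regroup : ∀ s d P → (s * P) * (s * P) + (d * P) * (d * P) ≡ (s * s + d * d) * P * P
  regroup = solve-∀
  distribute : ∀ B s A d P → (B * s - A * d) * P ≡ B * (s * P) - A * (d * P)
  distribute = solve-∀
  cross : ∀ A B t → B * (A * t + + 2 * B) - A * (B * t - + 2 * A) ≡ + 2 * (A * A + B * B)
  cross = solve-∀

≡1-mod-4⇒≢2 : ∀ {p} → + 4 ∣ + p - + 1 → p ≢ 2
≡1-mod-4⇒≢2 4∣1 refl with () ← ∣1⇒≡1 {4} 4∣1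

unit-norm≡-1 : ∀ {p t b} → Prime p → + 4 ∣ + p - + 1 → + p ∣ₛ t * t + + 4 → IsUnit p t b →
               t * t + + 4 ≡ b * b * + p
unit-norm≡-1 {p} {t} {b} _ _ _ (inj₂ norm≡-4) = begin
  t * t + + 4                                 ≡⟨ shift t b (+ p) ⟩
  (t * t - + p * (b * b)) + + 4 + b * b * + p ≡⟨ cong (λ n → n + + 4 + b * b * + p) norm≡-4 ⟩
  0ℤ + b * b * + p                            ≡⟨ +-identityˡ (b * b * + p) ⟩
  b * b * + p                                 ∎
  where
  open ≡-Reasoning
  shift : ∀ t b P → t * t + + 4 ≡ (t * t - P * (b * b)) + + 4 + b * b * P
  shift = solve-∀
unit-norm≡-1 {p} {t} {b} p-prime 4∣p-1 p∣t²+4 (inj₁ norm≡4) =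
  contradiction (prime∣8⇒≡2 p-prime (∣⇒∣ᵤ (subst (+ p ∣ₛ_) eight p∣eight))) (≡1-mod-4⇒≢2 4∣p-1)
  where
  regroup : ∀ t b P → (t * t + + 4) - P * (b * b) ≡ (t * t - P * (b * b)) + + 4
  regroup = solve-∀
  eight : (t * t + + 4) - + p * (b * b) ≡ + 8
  eight = trans (regroup t b (+ p)) (cong (_+ + 4) norm≡4)
  p∣eight : + p ∣ₛ (t * t + + 4) - + p * (b * b)
  p∣eight = ∣m∣n⇒∣m-n p∣t²+4 (∣m⇒∣m*n (b * b) (∣-refl {+ p}))

IntegralRoots : ℤ → ℤ → ℤ → ℤ → Set
IntegralRoots P b S D = ∃₂ λ (x₀ y₀ : ℤ) → 0ℤ ≤ x₀
  × (+ 2 * P) * (x₀ * x₀) ≡ b * P + S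
  × (+ 2 * P) * (y₀ * y₀) ≡ b * P - S
  × (+ 2 * P) * (x₀ * y₀) ≡ D

root-identities : ∀ {X Y e S D} P x y → X ≡ x * x → Y ≡ y * y → x * y ≡ e →
                        S ≡ (X - Y) * P → D ≡ (e * + 2) * P →
                        (+ 2 * P) * (x * x) ≡ (X + Y) * P + S
                      × (+ 2 * P) * (y * y) ≡ (X + Y) * P - S
                      × (+ 2 * P) * (x * y) ≡ D
root-identities P x y refl refl refl refl refl = sum P x y , difference P x y , product P x y
  where
  sum : ∀ P x y → (+ 2 * P) * (x * x) ≡ (x * x + y * y) * P + (x * x - y * y) * P
  sum = solve-∀
  difference : ∀ P x y → (+ 2 * P) * (y * y) ≡ (x * x + y * y) * P - (x * x - y * y) * P
  difference = solve-∀
  product : ∀ P x y → (+ 2 * P) * (x * y) ≡ (x * y * + 2) * P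
  product = solve-∀

integral-roots-of-halves : ∀ {P S D B b s d} A β X Y e →
                      B ≡ β * + 2 → d ≡ e * + 2 → b ≡ X + Y → s ≡ X - Y → 0ℤ < b →
                      s * s + d * d ≡ b * b → B * s - A * d ≡ + 2 →
                      S ≡ s * P → D ≡ d * P → IntegralRoots P b S D
integral-roots-of-halves {P} A β X Y e refl refl refl refl 0<X+Y pythagoras cross S≡[X-Y]P D≡2eP =
  let x , y , 0≤x , X≡xx , Y≡yy , xy≡e = square-roots-of-factors β A 0<X+Y
        (pythagorean-halves X Y e pythagoras) (halve-cross A β (X - Y) e cross)
  in x , y , 0≤x , root-identities {X} {Y} P x y X≡xx Y≡yy xy≡e S≡[X-Y]P D≡2eP

integral-roots : ∀ {P S D} A B b s d → 0ℤ < b → Even (A + 1ℤ) → Even B →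
                     s * s + d * d ≡ b * b → B * s - A * d ≡ + 2 →
                     S ≡ s * P → D ≡ d * P → IntegralRoots P b S D
integral-roots A B b s d 0<b 2∣A+1 2∣B s²+d²≡b² Bs-Ad≡2 =
  let divides β B≡2β = 2∣B
      divides e d≡2e = even-of-cross A B s d 2∣B (odd⇒¬even A 2∣A+1) Bs-Ad≡2
      X , Y , b≡X+Y , s≡X-Y = split-even-difference b s
                                 (even-leg-difference s d b (divides e d≡2e) s²+d²≡b²)
  in integral-roots-of-halves A β X Y e B≡2β d≡2e b≡X+Y s≡X-Y 0<b s²+d²≡b² Bs-Ad≡2

lemma7 : (p : ℕ) → Prime p → (+ 4) ∣ (+ p - + 1) →
    (t b : ℤ) → 0ℤ < t → 0ℤ < b → IsFundamentalUnit p t b →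
    (A B : ℤ) → + p ≡ A * A + B * B → (+ 4) ∣ (A + + 1) → (+ p) ∣ (A * t + + 2 * B) →
    ∃₂ λ (x₀ y₀ : ℤ) → 0ℤ ≤ x₀
      × (+ 2 * + p) * (x₀ * x₀) ≡ b * + p + (A * t + + 2 * B)
      × (+ 2 * + p) * (y₀ * y₀) ≡ b * + p - (A * t + + 2 * B)
      × (+ 2 * + p) * (x₀ * y₀) ≡ B * t - + 2 * A
lemma7 p p-prime 4∣p-1 t b _ 0<b (unit , _) A B p≡A²+B² 4∣A+1 p∣S =
  let p≢0 = prime⇒nonZero p-prime
      p∣S′ = ∣ᵤ⇒∣ {+ p} {A * t + + 2 * B} p∣S
      divides s S≡sp = p∣S′
      divides d D≡dp = complement-divisible A B t p-prime p≡A²+B² p∣S′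
      t²+4≡[s²+d²]p , Bs-Ad≡2 = quotient-identities A B t s d {{p≢0}} p≡A²+B² S≡sp D≡dp
      t²+4≡b²p = unit-norm≡-1 {p} {t} {b} p-prime 4∣p-1 (divides (s * s + d * d) t²+4≡[s²+d²]p) unit
      s²+d²≡b² = *-cancelʳ-≡ (s * s + d * d) (b * b) (+ p) {{p≢0}} (trans (sym t²+4≡[s²+d²]p) t²+4≡b²p)
      2∣A+1 = 4∣⇒even {A + 1ℤ} 4∣A+1
      2∣B = even-square-summand A B 2∣A+1
              (subst (λ n → Even (n - 1ℤ)) p≡A²+B² (4∣⇒even {+ p - 1ℤ} 4∣p-1))
  in integral-roots A B b s d 0<b 2∣A+1 2∣B s²+d²≡b² Bs-Ad≡2 S≡sp D≡dp
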